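{- Let $k$ be a positive integer. For every $0\leq\gamma<\frac14$ and every $\epsilon>0$ there exist an instance of Graph Balancing and a target makespan $T$ such that (1) the relaxation $LP_k$ for target $T$ is feasible, with optimal value $OPT_{LP_k}$, and (2) every orientation whose makespan is at most $(1.75+\gamma)T$ has orientation cost at least $\frac{1}{\gamma+0.75+\epsilon}\,OPT_{LP_k}$.
   Context: Graph Balancing: an undirected multigraph $G=(V,E)$ (self-loops allowed), edge weights $p:E\to\mathbb{R}^{+}$, nonnegative orientation costs $c_{e,u}$ for $e\in E$, $u\in e$. An orientation assigns each edge $e$ to an endpoint $\eta(e)\in e$; the load of $u$ is $\sum_{e:\eta(e)=u}p_e$, the makespan is the maximum load, and the orientation cost is $\sum_e c_{e,\eta(e)}$. For $u\in V$ let $\delta(u)$ be the set of edges incident to $u$. The relaxation $LP_k$ for target $T$ has variables $x_{e,u}\ge 0$ for $e\in E$, $u\in e$, and is: minimize $\sum_{e\in E}\sum_{u\in e}c_{e,u}x_{e,u}$ subject to (Edge) $\sum_{u\in e}x_{e,u}=1$ for all $e\in E$; (Load) $\sum_{e\in\delta(u)}x_{e,u}p_e\le T$ for all $u\in V$; (Star) $\sum_{e\in\delta(u):\,p_e>T/2}x_{e,u}\le 1$ for all $u\in V$; (Set) $\sum_{e\in S}x_{e,u}\le |S|-1$ for all $u\in V$ and all $S\subseteq\delta(u)$ with $\sum_{e\in S}p_e>T$ and $|S|\le k$; and $x_{e,u}=0$ whenever $p_e>T$. $OPT_{LP_k}$ denotes its optimal value.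
   Formalization: The parameters γ and ε range over the rationals; the edge weights, costs, target $T$ and variables $x_{e,u}$ are taken in the rationals, with $OPT_{LP_k}$ optimal among rational solutions. -}

module Defs where

open import Data.Nat using (ℕ)
open import Data.Bool using (Bool; true; false; if_then_else_; _∧_)
open import Data.Fin using (Fin)
open import Data.Fin.Subset using (Subset; ∣_∣) renaming (_∈_ to _∈ₛ_)
open import Data.Vec using (lookup)
open import Data.List using (List; []; _∷_; map; foldr; allFin)
open import Data.List.Membership.Propositional using (_∈_)
import Data.List.Membership.DecPropositional as DecMem
open import Data.Integer using (+_)
open import Data.Rational using (ℚ; 0ℚ; 1ℚ; ½; _+_; _*_; _-_; _≤_; _<_; _/_)
open import Data.Rational.Properties using (_<?_)
open import Relation.Nullary using (does)
open import Relation.Binary.PropositionalEquality using (_≡_)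
open import Data.Product using (Σ; _×_)

sumℚ : List ℚ → ℚ
sumℚ = foldr _+_ 0ℚ

Σ[_] : ∀ {m} → (Fin m → ℚ) → ℚ
Σ[_] {m} f = sumℚ (map f (allFin m))

[_]? : Bool → ℚ → ℚ
[ b ]? q = if b then q else 0ℚ

ℕ→ℚ : ℕ → ℚ
ℕ→ℚ k = + k / 1

-- A Graph Balancing instance: vertices Fin n, edges Fin m (a multigraph),
-- edge e has endpoints end₁ e, end₂ e (equal for a self-loop),
-- positive weights p, nonnegative orientation costs c e u (used for u ∈ e).
record Instance : Set where
  field
    n m      : ℕ
    end₁     : Fin m → Fin n
    end₂     : Fin m → Fin n
    p        : Fin m → ℚ
    p-pos    : ∀ e → 0ℚ < p e
    c        : Fin m → Fin n → ℚ
    c-nonneg : ∀ e u → 0ℚ ≤ c e u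

  ends : Fin m → List (Fin n)
  ends e = if does (end₁ e Data.Fin.≟ end₂ e) then end₁ e ∷ [] else end₁ e ∷ end₂ e ∷ []

  inc : Fin m → Fin n → Bool
  inc e u = does (DecMem._∈?_ {A = Fin n} Data.Fin._≟_ u (ends e))

  -- LP variables x e u (only meaningful for u ∈ e)
  LPCost : (Fin m → Fin n → ℚ) → ℚ
  LPCost x = Σ[ (λ e → sumℚ (map (λ u → c e u * x e u) (ends e))) ]

  IsOrientation : (Fin m → Fin n) → Set
  IsOrientation η = ∀ e → η e ∈ ends e

  load : (Fin m → Fin n) → Fin n → ℚ
  load η u = Σ[ (λ e → [ does (η e Data.Fin.≟ u) ]? (p e)) ]

  MakespanAtMost : (Fin m → Fin n) → ℚ → Set
  MakespanAtMost η B = ∀ u → load η u ≤ B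

  orientCost : (Fin m → Fin n) → ℚ
  orientCost η = Σ[ (λ e → c e (η e)) ]

  record LPFeasible (k : ℕ) (T : ℚ) (x : Fin m → Fin n → ℚ) : Set where
    field
      nonneg  : ∀ e u → u ∈ ends e → 0ℚ ≤ x e u
      edge    : ∀ e → sumℚ (map (x e) (ends e)) ≡ 1ℚ
      loadC   : ∀ u → Σ[ (λ e → [ inc e u ]? (x e u * p e)) ] ≤ T
      star    : ∀ u → Σ[ (λ e → [ inc e u ∧ does (T * ½ <? p e) ]? (x e u)) ] ≤ 1ℚ
      setC    : ∀ u (S : Subset m) → (∀ e → e ∈ₛ S → inc e u ≡ true)
                → T < Σ[ (λ e → [ lookup S e ]? (p e)) ]
                → ∣ S ∣ Data.Nat.≤ k
                → Σ[ (λ e → [ lookup S e ]? (x e u)) ] ≤ ℕ→ℚ ∣ S ∣ - 1ℚ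
      big     : ∀ e u → u ∈ ends e → T < p e → x e u ≡ 0ℚ

  -- x is an optimal solution of LP_k for target T (so LPCost x = OPT_{LP_k})
  IsOptimalLP : ℕ → ℚ → (Fin m → Fin n → ℚ) → Set
  IsOptimalLP k T x = LPFeasible k T x × (∀ y → LPFeasible k T y → LPCost x ≤ LPCost y)

-- Two vertices 0 and 1, a heavy edge of weight 1 - h between them (free at 0, cost 1 at 1) and
-- N self-loops at 0 of total weight L = 1 - f (1 - h), with target T = 1.  The loops must sit
-- on vertex 0, so an LP solution puts at most the fraction f of the heavy edge there, and
-- OPT = 1 - f.  Each loop is so light that K + 1 of them weigh at most h: no k = K + 1 edges at
-- a vertex weigh more than T, so the Set constraints are void.  An orientation putting the heavy
-- edge on 0 has makespan (1 - h) + L, so below that bound every orientation costs 1.  With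
-- h = min(1/4 - γ, ε) / 2 and f = 1/4 - γ - h one gets OPT = 3/4 + γ + h ≤ 3/4 + γ + ε and
-- (1 - h) + L = 7/4 + γ + f h > 7/4 + γ.

module Submission where

open import Defs
open import Data.Nat using (ℕ)
open import Data.Integer using (+_)
open import Data.Rational using (ℚ; 0ℚ; _+_; _*_; _≤_; _<_; _/_)
open import Data.Product using (Σ; _×_)
open import Data.Fin using (Fin)

open import Algebra.Bundles using (CommutativeRing)
open import Data.Nat as ℕ using (zero; suc; z≤n; s≤s)
import Data.Nat.Properties as ℕ
open import Data.Integer as ℤ using (+[1+_]; -[1+_]; +<+; +≤+)
import Data.Integer.Solver as ℤSolver
open import Data.Rational
  using (1ℚ; ½; _-_; -_; _⊓_; ↥_; ↧_; 1/_; mkℚ; toℚᵘ; *<*; *≤*; Positive; positive; nonNegative)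
open import Data.Rational.Properties
import Data.Rational.Solver as ℚSolver
open import Data.Rational.Unnormalised as ℚᵘ using (mkℚᵘ; *≡*) renaming (_≃_ to _≃ᵘ_)
import Data.Rational.Unnormalised.Properties as ℚᵘ
open import Data.Product using (_,_; proj₁; proj₂; ∃-syntax)
open import Data.Sum using (inj₁; inj₂)
open import Data.Empty using (⊥-elim)
open import Data.Fin using (zero; suc)
open import Data.Fin.Subset using (Subset; ∣_∣) renaming (_∈_ to _∈ₛ_)
open import Data.Fin.Subset.Properties using (∣p∣≤n)
open import Data.Bool using (true; false; _∧_)
open import Data.Vec using ([]; _∷_; lookup)
open import Data.Vec.Properties using (lookup⇒[]=)
open import Data.List using (map; allFin)
open import Data.List.Properties using (map-tabulate; map-cong)
open import Data.List.Relation.Unary.Any using (here; there)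
open import Function using (_∘_; id)
open import Relation.Nullary using (¬_)
open import Relation.Nullary.Decidable using (does; dec-false)
open import Relation.Binary.PropositionalEquality

open import Algebra.Properties.Semiring.Mult (CommutativeRing.semiring +-*-commutativeRing)
  using (×-assoc-*; ×-assocˡ; ×-homo-1) renaming (_×_ to _·_)

p+[q-p]≡q : ∀ p q → p + (q - p) ≡ q
p+[q-p]≡q = solve 2 (λ p q → p :+ (q :- p) := q) refl
  where open ℚSolver.+-*-Solver

p≤q⇒0≤q-p : ∀ {p q} → p ≤ q → 0ℚ ≤ q - p
p≤q⇒0≤q-p {p} {q} p≤q = subst (_≤ q - p) (+-inverseʳ p) (+-monoˡ-≤ (- p) p≤q)

p<q⇒0<q-p : ∀ {p q} → p < q → 0ℚ < q - p
p<q⇒0<q-p {p} {q} p<q = subst (_< q - p) (+-inverseʳ p) (+-monoˡ-< (- p) p<q)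

0≤q-p⇒p≤q : ∀ {p q} → 0ℚ ≤ q - p → p ≤ q
0≤q-p⇒p≤q {p} {q} 0≤q-p = subst₂ _≤_ (+-identityʳ p) (p+[q-p]≡q p q) (+-monoʳ-≤ p 0≤q-p)

0<q-p⇒p<q : ∀ {p q} → 0ℚ < q - p → p < q
0<q-p⇒p<q {p} {q} 0<q-p = subst₂ _<_ (+-identityʳ p) (p+[q-p]≡q p q) (+-monoʳ-< p 0<q-p)

p-q≤p : ∀ p {q} → 0ℚ ≤ q → p - q ≤ p
p-q≤p p 0≤q = ≤-trans (+-monoʳ-≤ p (neg-antimono-≤ 0≤q)) (≤-reflexive (+-identityʳ p))

+-cancelʳ-≤ : ∀ r {p q} → p + r ≤ q + r → p ≤ q
+-cancelʳ-≤ r {p} {q} le = subst₂ _≤_ (p+r-r≡p p) (p+r-r≡p q) (+-monoˡ-≤ (- r) le)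
  where
  p+r-r≡p : ∀ p → p + r - r ≡ p
  p+r-r≡p p = solve 2 (λ p r → p :+ r :- r := p) refl p r
    where open ℚSolver.+-*-Solver

≤⇒≯ : ∀ {p q} → p ≤ q → ¬ q < p
≤⇒≯ p≤q q<p = <-irrefl refl (<-≤-trans q<p p≤q)

*-pres-≤1 : ∀ {p q} → 0ℚ ≤ p → p ≤ 1ℚ → q ≤ 1ℚ → p * q ≤ 1ℚ
*-pres-≤1 {p} 0≤p p≤1 q≤1 =
  ≤-trans (*-monoˡ-≤-nonNeg p {{nonNegative 0≤p}} q≤1) (≤-trans (≤-reflexive (*-identityʳ p)) p≤1)

*-pres-0≤ : ∀ {p q} → 0ℚ ≤ p → 0ℚ ≤ q → 0ℚ ≤ p * q
*-pres-0≤ {p} {q} 0≤p 0≤q =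
  nonNegative⁻¹ _ {{nonNeg*nonNeg⇒nonNeg p {{nonNegative 0≤p}} q {{nonNegative 0≤q}}}}

*-pres-0< : ∀ {p q} → 0ℚ < p → 0ℚ < q → 0ℚ < p * q
*-pres-0< {p} {q} 0<p 0<q = positive⁻¹ _ {{pos*pos⇒pos p {{positive 0<p}} q {{positive 0<q}}}}

0<½ : 0ℚ < ½
0<½ = *<* (+<+ (s≤s z≤n))

½<1 : ½ < 1ℚ
½<1 = *<* (+<+ (s≤s (s≤s z≤n)))

⊓-pres-0< : ∀ {p q} → 0ℚ < p → 0ℚ < q → 0ℚ < p ⊓ q
⊓-pres-0< {p} {q} 0<p 0<q with ⊓-sel p q
... | inj₁ p⊓q≡p = subst (0ℚ <_) (sym p⊓q≡p) 0<p
... | inj₂ p⊓q≡q = subst (0ℚ <_) (sym p⊓q≡q) 0<q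

·-≡-* : ∀ n p → n · p ≡ (n · 1ℚ) * p
·-≡-* n p = trans (cong (n ·_) (sym (*-identityˡ p))) (sym (×-assoc-* n 1ℚ p))

·-zeroʳ : ∀ n → n · 0ℚ ≡ 0ℚ
·-zeroʳ n = trans (·-≡-* n 0ℚ) (*-zeroʳ (n · 1ℚ))

·-nonNeg : ∀ n {p} → 0ℚ ≤ p → 0ℚ ≤ n · p
·-nonNeg zero    _   = ≤-refl
·-nonNeg (suc n) 0≤p = +-mono-≤ 0≤p (·-nonNeg n 0≤p)

·-pos : ∀ n .{{_ : ℕ.NonZero n}} {p} → 0ℚ < p → 0ℚ < n · p
·-pos (suc n) 0<p = +-mono-<-≤ 0<p (·-nonNeg n (<⇒≤ 0<p))

·-monoˡ-≤ : ∀ {m n p} → m ℕ.≤ n → 0ℚ ≤ p → m · p ≤ n · p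
·-monoˡ-≤ {n = n} z≤n       0≤p = ·-nonNeg n 0≤p
·-monoˡ-≤ {p = p} (s≤s m≤n) 0≤p = +-monoʳ-≤ p (·-monoˡ-≤ m≤n 0≤p)

·1-positive : ∀ n .{{_ : ℕ.NonZero n}} → Positive (n · 1ℚ)
·1-positive n = positive (·-pos n (positive⁻¹ 1ℚ))

·-cancelˡ-≤ : ∀ n .{{_ : ℕ.NonZero n}} {p q} → n · p ≤ n · q → p ≤ q
·-cancelˡ-≤ n {p} {q} le =
  *-cancelˡ-≤-pos (n · 1ℚ) {{·1-positive n}}
    (subst₂ _≤_ (·-≡-* n p) (·-≡-* n q) le)

infixl 7 _/ₙ_

_/ₙ_ : ℚ → (n : ℕ) → .{{ℕ.NonZero n}} → ℚ
p /ₙ n = p * (1/ (n · 1ℚ)) {{pos⇒nonZero (n · 1ℚ) {{·1-positive n}}}}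

/ₙ-pres-0< : ∀ n .{{_ : ℕ.NonZero n}} {p} → 0ℚ < p → 0ℚ < p /ₙ n
/ₙ-pres-0< n 0<p = *-pres-0< 0<p (positive⁻¹ _ {{1/pos⇒pos (n · 1ℚ) {{·1-positive n}}}})

·-/ₙ : ∀ n .{{_ : ℕ.NonZero n}} p → n · (p /ₙ n) ≡ p
·-/ₙ n p = begin
  n · (p * r⁻¹)  ≡⟨ ·-≡-* n _ ⟩
  r * (p * r⁻¹)  ≡⟨ *-comm r _ ⟩
  p * r⁻¹ * r    ≡⟨ *-assoc p _ r ⟩
  p * (r⁻¹ * r)  ≡⟨ cong (p *_) (*-inverseˡ r {{nz}}) ⟩
  p * 1ℚ         ≡⟨ *-identityʳ p ⟩
  p              ∎
  where
  open ≡-Reasoning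
  r = n · 1ℚ
  nz = pos⇒nonZero r {{·1-positive n}}
  r⁻¹ = (1/ r) {{nz}}

toℚᵘ-· : ∀ n q → toℚᵘ (n · q) ≃ᵘ mkℚᵘ (+ n ℤ.* ↥ q) (ℚ.denominator-1 q)
toℚᵘ-· zero    q = *≡* (solve 2 (λ i d → con (+ 0) := con (+ 0) :* i :* d) refl (↥ q) (↧ q))
  where open ℤSolver.+-*-Solver
toℚᵘ-· (suc n) q@record{} = ℚᵘ.≃-trans (toℚᵘ-homo-+ q (n · q))
  (ℚᵘ.≃-trans (ℚᵘ.+-congʳ (toℚᵘ q) (toℚᵘ-· n q)) (*≡* (step (↥ q) (+ n) (↧ q))))
  where
  open ℤSolver.+-*-Solver
  step : ∀ i n D → (i ℤ.* D ℤ.+ n ℤ.* i ℤ.* D) ℤ.* D ≡ (+ 1 ℤ.+ n) ℤ.* i ℤ.* (D ℤ.* D)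
  step = solve 3 (λ i n D → (i :* D :+ n :* i :* D) :* D := (con (+ 1) :+ n) :* i :* (D :* D)) refl

-- For q = (i + 1) / (d + 1) one has (d + 1) · q = i + 1.
archimedean : ∀ {q} → 0ℚ < q → ∃[ n ] 1ℚ ≤ suc n · q
archimedean {mkℚ (+ zero)   _ _} (*<* (+<+ ()))
archimedean {mkℚ -[1+ _ ]   _ _} (*<* ())
archimedean {q@(mkℚ +[1+ i ] d _)} _ = d , toℚᵘ-cancel-≤
  (ℚᵘ.≤-respʳ-≃ (ℚᵘ.≃-sym (toℚᵘ-· (suc d) q)) (ℚᵘ.*≤* (+≤+ d≤)))
  where
  d≤ : 1 ℕ.* suc d ℕ.≤ suc d ℕ.* suc i ℕ.* 1
  d≤ = subst (ℕ._≤ suc d ℕ.* suc i ℕ.* 1) (ℕ.*-comm (suc d) 1) (ℕ.*-monoˡ-≤ 1 (ℕ.m≤m*n (suc d) (suc i)))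

Σ-suc : ∀ {m} (f : Fin (suc m) → ℚ) → Σ[ f ] ≡ f zero + Σ[ f ∘ suc ]
Σ-suc f = cong (λ xs → f zero + sumℚ xs)
  (trans (map-tabulate suc f) (sym (map-tabulate id (f ∘ suc))))

Σ-cong : ∀ {m} {f g : Fin m → ℚ} → (∀ i → f i ≡ g i) → Σ[ f ] ≡ Σ[ g ]
Σ-cong {m} f≗g = cong sumℚ (map-cong f≗g (allFin m))

Σ-const : ∀ m p → Σ[ (λ (_ : Fin m) → p) ] ≡ m · p
Σ-const zero    p = refl
Σ-const (suc m) p = trans (Σ-suc {m} (λ _ → p)) (cong (_+_ p) (Σ-const m p))

Σ-zero : ∀ m → Σ[ (λ (_ : Fin m) → 0ℚ) ] ≡ 0ℚ
Σ-zero m = trans (Σ-const m 0ℚ) (·-zeroʳ m)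

Σ-indicator : ∀ {m} (S : Subset m) p → Σ[ (λ i → [ lookup S i ]? p) ] ≡ ∣ S ∣ · p
Σ-indicator []          p = refl
Σ-indicator (true ∷ S)  p =
  trans (Σ-suc (λ i → [ lookup (true ∷ S) i ]? p)) (cong (_+_ p) (Σ-indicator S p))
Σ-indicator (false ∷ S) p =
  trans (Σ-suc (λ i → [ lookup (false ∷ S) i ]? p)) (trans (+-identityˡ _) (Σ-indicator S p))

[]?-≤ : ∀ b {p} → 0ℚ ≤ p → [ b ]? p ≤ p
[]?-≤ true  _   = ≤-refl
[]?-≤ false 0≤p = 0≤p

[<?]-≡-0 : ∀ {p q} r → q ≤ p → [ does (p <? q) ]? r ≡ 0ℚ
[<?]-≡-0 {p} {q} r q≤p = cong (λ b → [ b ]? r) (dec-false (p <? q) (≤⇒≯ q≤p))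

Σ-head : ∀ {m} (F : Fin (suc m) → ℚ) → (∀ i → F (suc i) ≡ 0ℚ) → Σ[ F ] ≡ F zero
Σ-head {m} F tail≡0 =
  trans (Σ-suc F) (trans (cong (_+_ (F zero)) (trans (Σ-cong tail≡0) (Σ-zero m))) (+-identityʳ (F zero)))

-- Edge zero is the heavy edge from vertex 0 to vertex 1, edge suc i the i-th loop at vertex 0.
module GapInstance (K N : ℕ) (f h w : ℚ)
  (0≤h : 0ℚ ≤ h) (h<1 : h < 1ℚ) (0≤f : 0ℚ ≤ f) (f≤1 : f ≤ 1ℚ)
  (0<w : 0ℚ < w) (w≤½ : w ≤ ½) (K·w≤h : K · w ≤ h)
  (balance : f * (1ℚ - h) + N · w ≡ 1ℚ) where

  open ℚSolver.+-*-Solver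

  other-end : Fin (suc N) → Fin 2
  other-end zero    = suc zero
  other-end (suc _) = zero

  weight : Fin (suc N) → ℚ
  weight zero    = 1ℚ - h
  weight (suc _) = w

  cost : Fin (suc N) → Fin 2 → ℚ
  cost zero (suc _) = 1ℚ
  cost _    _       = 0ℚ

  0<1-h : 0ℚ < 1ℚ - h
  0<1-h = p<q⇒0<q-p h<1

  weight-pos : ∀ e → 0ℚ < weight e
  weight-pos zero    = 0<1-h
  weight-pos (suc _) = 0<w

  cost-nonNeg : ∀ e u → 0ℚ ≤ cost e u
  cost-nonNeg zero    zero    = ≤-refl
  cost-nonNeg zero    (suc _) = <⇒≤ (positive⁻¹ 1ℚ)
  cost-nonNeg (suc _) _       = ≤-refl

  gap : Instance
  gap = record
    { n = 2 ; m = suc N ; end₁ = λ _ → zero ; end₂ = other-end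
    ; p = weight ; p-pos = weight-pos ; c = cost ; c-nonneg = cost-nonNeg }

  open Instance gap

  1-h≤1 : 1ℚ - h ≤ 1ℚ
  1-h≤1 = p-q≤p 1ℚ 0≤h

  N·w≤1 : N · w ≤ 1ℚ
  N·w≤1 = subst₂ _≤_ (+-identityˡ (N · w)) balance
    (+-monoˡ-≤ (N · w) (*-pres-0≤ 0≤f (<⇒≤ 0<1-h)))

  1-f≤1 : 1ℚ - f ≤ 1ℚ
  1-f≤1 = p-q≤p 1ℚ 0≤f

  weight-≤1 : ∀ e → weight e ≤ 1ℚ
  weight-≤1 zero    = 1-h≤1
  weight-≤1 (suc _) = ≤-trans w≤½ (<⇒≤ ½<1)

  x : Fin (suc N) → Fin 2 → ℚ
  x zero zero    = f
  x zero (suc _) = 1ℚ - f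
  x (suc _) _    = 1ℚ

  LPCost≡ : ∀ (y : Fin (suc N) → Fin 2 → ℚ) → LPCost y ≡ y zero (suc zero)
  LPCost≡ y = trans (Σ-head F (λ i → loop (y (suc i) zero))) (heavy (y zero zero) (y zero (suc zero)))
    where
    F = λ e → sumℚ (map (λ u → cost e u * y e u) (ends e))
    heavy : ∀ p q → 0ℚ * p + (1ℚ * q + 0ℚ) ≡ q
    heavy = solve 2 (λ p q → con 0ℚ :* p :+ (con 1ℚ :* q :+ con 0ℚ) := q) refl
    loop : ∀ p → 0ℚ * p + 0ℚ ≡ 0ℚ
    loop p = trans (+-identityʳ _) (*-zeroˡ p)

  load-at-0 : ∀ (y : Fin (suc N) → Fin 2 → ℚ) → (∀ i → y (suc i) zero ≡ 1ℚ) →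
    Σ[ (λ e → [ inc e zero ]? (y e zero * weight e)) ] ≡ y zero zero * (1ℚ - h) + N · w
  load-at-0 y loops = trans (Σ-suc (λ e → [ inc e zero ]? (y e zero * weight e)))
    (cong (_+_ (y zero zero * (1ℚ - h)))
      (trans (Σ-cong {g = λ _ → w} (λ i → trans (cong (_* w) (loops i)) (*-identityˡ w))) (Σ-const N w)))

  x-load : ∀ u → Σ[ (λ e → [ inc e u ]? (x e u * weight e)) ] ≤ 1ℚ
  x-load zero       = ≤-reflexive (trans (load-at-0 x (λ _ → refl)) balance)
  x-load (suc zero) = begin
    Σ[ F ]               ≡⟨ Σ-head F (λ _ → refl) ⟩
    (1ℚ - f) * (1ℚ - h)  ≤⟨ *-pres-≤1 (p≤q⇒0≤q-p f≤1) 1-f≤1 1-h≤1 ⟩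
    1ℚ                   ∎
    where
    open ≤-Reasoning
    F = λ e → [ inc e (suc zero) ]? (x e (suc zero) * weight e)

  x-star : ∀ u → Σ[ (λ e → [ inc e u ∧ does (1ℚ * ½ <? weight e) ]? (x e u)) ] ≤ 1ℚ
  x-star zero       = begin
    Σ[ F ]                        ≡⟨ Σ-head F (λ _ → [<?]-≡-0 1ℚ w≤½) ⟩
    [ does (½ <? (1ℚ - h)) ]? f   ≤⟨ []?-≤ _ 0≤f ⟩
    f                             ≤⟨ f≤1 ⟩
    1ℚ                            ∎
    where
    open ≤-Reasoning
    F = λ e → [ inc e zero ∧ does (1ℚ * ½ <? weight e) ]? (x e zero)
  x-star (suc zero) = begin
    Σ[ F ]                               ≡⟨ Σ-head F (λ _ → refl) ⟩
    [ does (½ <? (1ℚ - h)) ]? (1ℚ - f)   ≤⟨ []?-≤ _ (p≤q⇒0≤q-p f≤1) ⟩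
    1ℚ - f                               ≤⟨ 1-f≤1 ⟩
    1ℚ                                   ∎
    where
    open ≤-Reasoning
    F = λ e → [ inc e (suc zero) ∧ does (1ℚ * ½ <? weight e) ]? (x e (suc zero))

  light-sets : ∀ u (S : Subset (suc N)) → (∀ e → e ∈ₛ S → inc e u ≡ true) → ∣ S ∣ ℕ.≤ suc K →
               Σ[ (λ e → [ lookup S e ]? (weight e)) ] ≤ 1ℚ
  light-sets zero (true ∷ S) _ (s≤s |S|≤K) = begin
    Σ[ (λ e → [ lookup (true ∷ S) e ]? (weight e)) ]
      ≡⟨ Σ-suc (λ e → [ lookup (true ∷ S) e ]? (weight e)) ⟩
    (1ℚ - h) + Σ[ (λ i → [ lookup S i ]? w) ]  ≡⟨ cong (_+_ (1ℚ - h)) (Σ-indicator S w) ⟩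
    (1ℚ - h) + ∣ S ∣ · w                       ≤⟨ +-monoʳ-≤ (1ℚ - h) (≤-trans (·-monoˡ-≤ |S|≤K (<⇒≤ 0<w)) K·w≤h) ⟩
    (1ℚ - h) + h                               ≡⟨ solve 1 (λ h → (con 1ℚ :- h) :+ h := con 1ℚ) refl h ⟩
    1ℚ                                         ∎
    where open ≤-Reasoning
  light-sets zero (false ∷ S) _ _ = begin
    Σ[ (λ e → [ lookup (false ∷ S) e ]? (weight e)) ]
      ≡⟨ Σ-suc (λ e → [ lookup (false ∷ S) e ]? (weight e)) ⟩
    0ℚ + Σ[ (λ i → [ lookup S i ]? w) ]  ≡⟨ trans (+-identityˡ _) (Σ-indicator S w) ⟩
    ∣ S ∣ · w                            ≤⟨ ·-monoˡ-≤ (∣p∣≤n S) (<⇒≤ 0<w) ⟩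
    N · w                                ≤⟨ N·w≤1 ⟩
    1ℚ                                   ∎
    where open ≤-Reasoning
  light-sets (suc zero) (s ∷ S) S⊆δ _ = begin
    Σ[ (λ e → [ lookup (s ∷ S) e ]? (weight e)) ]
      ≡⟨ Σ-head (λ e → [ lookup (s ∷ S) e ]? (weight e)) no-loop ⟩
    [ s ]? (1ℚ - h)  ≤⟨ []?-≤ s (<⇒≤ 0<1-h) ⟩
    1ℚ - h           ≤⟨ 1-h≤1 ⟩
    1ℚ               ∎
    where
    open ≤-Reasoning
    no-loop : ∀ i → [ lookup S i ]? w ≡ 0ℚ
    no-loop i with lookup S i in eq
    ... | false = refl
    ... | true with () ← S⊆δ (suc i) (lookup⇒[]= (suc i) (s ∷ S) eq)

  x-feasible : LPFeasible (suc K) 1ℚ x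
  x-feasible = record
    { nonneg = λ e u _ → x-nonNeg e u
    ; edge   = x-edge
    ; loadC  = x-load
    ; star   = x-star
    ; setC   = λ u S S⊆δ 1<Σ |S|≤k → ⊥-elim (≤⇒≯ (light-sets u S S⊆δ |S|≤k) 1<Σ)
    ; big    = λ e _ _ 1<p → ⊥-elim (≤⇒≯ (weight-≤1 e) 1<p)
    }
    where
    x-nonNeg : ∀ e u → 0ℚ ≤ x e u
    x-nonNeg zero    zero    = 0≤f
    x-nonNeg zero    (suc _) = p≤q⇒0≤q-p f≤1
    x-nonNeg (suc _) _       = <⇒≤ (positive⁻¹ 1ℚ)
    x-edge : ∀ e → sumℚ (map (x e) (ends e)) ≡ 1ℚ
    x-edge zero    = solve 1 (λ f → f :+ ((con 1ℚ :- f) :+ con 0ℚ) := con 1ℚ) refl f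
    x-edge (suc _) = refl

  x-optimal : ∀ y → LPFeasible (suc K) 1ℚ y → LPCost x ≤ LPCost y
  x-optimal y y-feasible = begin
    LPCost x           ≡⟨ LPCost≡ x ⟩
    1ℚ - f             ≤⟨ +-monoʳ-≤ 1ℚ (neg-antimono-≤ y₀≤f) ⟩
    1ℚ - y zero zero   ≡⟨ cong (_- y zero zero) (sym (edge zero)) ⟩
    y zero zero + (y zero (suc zero) + 0ℚ) - y zero zero
                       ≡⟨ solve 2 (λ p q → p :+ (q :+ con 0ℚ) :- p := q) refl (y zero zero) (y zero (suc zero)) ⟩
    y zero (suc zero)  ≡⟨ LPCost≡ y ⟨
    LPCost y           ∎
    where
    open ≤-Reasoning
    open LPFeasible y-feasible
    y₀≤f : y zero zero ≤ f
    y₀≤f = *-cancelʳ-≤-pos (1ℚ - h) {{positive 0<1-h}} (+-cancelʳ-≤ (N · w) (begin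
      y zero zero * (1ℚ - h) + N · w  ≡⟨ load-at-0 y (λ i → trans (sym (+-identityʳ _)) (edge (suc i))) ⟨
      _                               ≤⟨ loadC zero ⟩
      1ℚ                              ≡⟨ balance ⟨
      f * (1ℚ - h) + N · w            ∎))

  orientCost≡1 : ∀ η {B} → IsOrientation η → MakespanAtMost η B → B < (1ℚ - h) + N · w →
               orientCost η ≡ 1ℚ
  orientCost≡1 η η-orients makespan B<load with η-orients zero
  ... | there (here η₀≡1) = trans (Σ-head (λ e → cost e (η e)) (λ _ → refl)) (cong (cost zero) η₀≡1)
  ... | here η₀≡0 = ⊥-elim (≤⇒≯ (makespan zero) (<-≤-trans B<load (≤-reflexive (sym load₀))))
    where
    loop-at-0 : ∀ i → η (suc i) ≡ zero
    loop-at-0 i with η-orients (suc i)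
    ... | here ηᵢ≡0 = ηᵢ≡0
    load₀ : load η zero ≡ (1ℚ - h) + N · w
    load₀ = trans (Σ-suc (λ e → [ does (η e Data.Fin.≟ zero) ]? (weight e)))
      (cong₂ _+_ (cong (λ v → [ does (v Data.Fin.≟ zero) ]? (1ℚ - h)) η₀≡0)
        (trans (Σ-cong (λ i → cong (λ v → [ does (v Data.Fin.≟ zero) ]? w) (loop-at-0 i))) (Σ-const N w)))

module Parameters (K : ℕ) (γ ε : ℚ) (0≤γ : 0ℚ ≤ γ) (γ<¼ : γ < + 1 / 4) (0<ε : 0ℚ < ε) where

  open ℚSolver.+-*-Solver

  ¼≤½ : + 1 / 4 ≤ ½
  ¼≤½ = *≤* (+≤+ (s≤s (s≤s z≤n)))

  0≤¾ : 0ℚ ≤ + 3 / 4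
  0≤¾ = *≤* (+≤+ z≤n)

  a t h f L : ℚ
  a = + 1 / 4 - γ
  t = a ⊓ ε
  h = t * ½
  f = a - h
  L = 1ℚ - f * (1ℚ - h)

  0<h : 0ℚ < h
  0<h = *-pres-0< (⊓-pres-0< (p<q⇒0<q-p γ<¼) 0<ε) 0<½

  h<t : h < t
  h<t = 0<q-p⇒p<q (subst (0ℚ <_) (solve 1 (λ t → t :* con ½ := t :- t :* con ½) refl t) 0<h)

  h<a : h < a
  h<a = <-≤-trans h<t (p⊓q≤p a ε)

  h≤ε : h ≤ ε
  h≤ε = <⇒≤ (<-≤-trans h<t (p⊓q≤q a ε))

  h≤½ : h ≤ ½
  h≤½ = ≤-trans (<⇒≤ h<a) (≤-trans (p-q≤p (+ 1 / 4) 0≤γ) ¼≤½)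

  0<f : 0ℚ < f
  0<f = p<q⇒0<q-p h<a

  h<1 : h < 1ℚ
  h<1 = ≤-<-trans h≤½ ½<1

  f≤1 : f ≤ 1ℚ
  f≤1 = ≤-trans (p-q≤p a (<⇒≤ 0<h)) (≤-trans (p-q≤p (+ 1 / 4) 0≤γ) (<⇒≤ (≤-<-trans ¼≤½ ½<1)))

  1-f≡¾+γ+h : 1ℚ - f ≡ + 3 / 4 + γ + h
  1-f≡¾+γ+h = solve 2 (λ γ h → con 1ℚ :- ((con (+ 1 / 4) :- γ) :- h) := con (+ 3 / 4) :+ γ :+ h) refl γ h

  heavy+L≡7/4+γ+fh : (1ℚ - h) + L ≡ + 7 / 4 + γ + f * h
  heavy+L≡7/4+γ+fh = solve 2 (λ γ h →
      (con 1ℚ :- h) :+ (con 1ℚ :- ((con (+ 1 / 4) :- γ) :- h) :* (con 1ℚ :- h))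
    := con (+ 7 / 4) :+ γ :+ ((con (+ 1 / 4) :- γ) :- h) :* h) refl γ h

  0<1-f : 0ℚ < 1ℚ - f
  0<1-f = subst (0ℚ <_) (sym 1-f≡¾+γ+h)
    (+-mono-≤-< (+-mono-≤ 0≤¾ 0≤γ) 0<h)

  0≤f[1-h] : 0ℚ ≤ f * (1ℚ - h)
  0≤f[1-h] = *-pres-0≤ (<⇒≤ 0<f) (p≤q⇒0≤q-p (<⇒≤ h<1))

  0<L : 0ℚ < L
  0<L = <-≤-trans 0<1-f (0≤q-p⇒p≤q (subst (0ℚ ≤_) (sym L-[1-f]≡fh) (*-pres-0≤ (<⇒≤ 0<f) (<⇒≤ 0<h))))
    where
    L-[1-f]≡fh : L - (1ℚ - f) ≡ f * h
    L-[1-f]≡fh = solve 2 (λ f h → (con 1ℚ :- f :* (con 1ℚ :- h)) :- (con 1ℚ :- f) := f :* h) refl f h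

  -- N = (d + 1)(K + 1) loops of weight L / N with 1 ≤ (d + 1) h, so K + 1 loops weigh at most h.
  d : ℕ
  d = proj₁ (archimedean 0<h)

  N : ℕ
  N = suc d ℕ.* suc K

  w : ℚ
  w = L /ₙ N

  N·w≡L : N · w ≡ L
  N·w≡L = ·-/ₙ N L

  [1+K]·w≤h : suc K · w ≤ h
  [1+K]·w≤h = ·-cancelˡ-≤ (suc d) (begin
    suc d · (suc K · w)  ≡⟨ ×-assocˡ w (suc d) (suc K) ⟩
    N · w                ≡⟨ N·w≡L ⟩
    L                    ≤⟨ p-q≤p 1ℚ 0≤f[1-h] ⟩
    1ℚ                   ≤⟨ proj₂ (archimedean 0<h) ⟩
    suc d · h            ∎)
    where open ≤-Reasoning

  0<w : 0ℚ < w
  0<w = /ₙ-pres-0< N 0<L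

  K·w≤h : K · w ≤ h
  K·w≤h = ≤-trans (·-monoˡ-≤ (ℕ.n≤1+n K) (<⇒≤ 0<w)) [1+K]·w≤h

  w≤½ : w ≤ ½
  w≤½ = begin
    w            ≡⟨ ×-homo-1 w ⟨
    1 · w        ≤⟨ ·-monoˡ-≤ {1} {suc K} (s≤s z≤n) (<⇒≤ 0<w) ⟩
    suc K · w    ≤⟨ [1+K]·w≤h ⟩
    h            ≤⟨ h≤½ ⟩
    ½            ∎
    where open ≤-Reasoning

  balance : f * (1ℚ - h) + N · w ≡ 1ℚ
  balance = trans (cong (_+_ (f * (1ℚ - h))) N·w≡L) (p+[q-p]≡q (f * (1ℚ - h)) 1ℚ)

  7/4+γ<heavy+N·w : + 7 / 4 + γ < (1ℚ - h) + N · w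
  7/4+γ<heavy+N·w = begin-strict
    + 7 / 4 + γ           ≡⟨ +-identityʳ _ ⟨
    + 7 / 4 + γ + 0ℚ      <⟨ +-monoʳ-< (+ 7 / 4 + γ) (*-pres-0< 0<f 0<h) ⟩
    + 7 / 4 + γ + f * h   ≡⟨ heavy+L≡7/4+γ+fh ⟨
    (1ℚ - h) + L          ≡⟨ cong (_+_ (1ℚ - h)) N·w≡L ⟨
    (1ℚ - h) + N · w      ∎
    where open ≤-Reasoning

  1-f≤γ+¾+ε : 1ℚ - f ≤ γ + + 3 / 4 + ε
  1-f≤γ+¾+ε = begin
    1ℚ - f            ≡⟨ 1-f≡¾+γ+h ⟩
    + 3 / 4 + γ + h   ≤⟨ +-monoʳ-≤ (+ 3 / 4 + γ) h≤ε ⟩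
    + 3 / 4 + γ + ε   ≡⟨ cong (_+ ε) (+-comm (+ 3 / 4) γ) ⟩
    γ + + 3 / 4 + ε   ∎
    where open ≤-Reasoning

theorem3 : (k : ℕ) → 1 Data.Nat.≤ k →
    (γ ε : ℚ) → 0ℚ ≤ γ → γ < + 1 / 4 → 0ℚ < ε →
    Σ Instance λ I → let open Instance I in
    Σ ℚ λ T → Σ (Fin m → Fin n → ℚ) λ x →
      0ℚ < T × IsOptimalLP k T x × 0ℚ < LPCost x ×
      ((η : Fin m → Fin n) → IsOrientation η →
        MakespanAtMost η ((+ 7 / 4 + γ) * T) →
        LPCost x ≤ (γ + + 3 / 4 + ε) * orientCost η)
theorem3 (suc K) _ γ ε 0≤γ γ<¼ 0<ε =
  gap , 1ℚ , x , positive⁻¹ 1ℚ , (x-feasible , x-optimal) ,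
  subst (0ℚ <_) (sym (LPCost≡ x)) 0<1-f , ratio
  where
  open Parameters K γ ε 0≤γ γ<¼ 0<ε
  open GapInstance K N f h w (<⇒≤ 0<h) h<1 (<⇒≤ 0<f) f≤1 0<w w≤½ K·w≤h balance
  open Instance gap
  ratio : ∀ η → IsOrientation η → MakespanAtMost η ((+ 7 / 4 + γ) * 1ℚ) →
          LPCost x ≤ (γ + + 3 / 4 + ε) * orientCost η
  ratio η η-orients makespan = begin
    LPCost x                           ≡⟨ LPCost≡ x ⟩
    1ℚ - f                             ≤⟨ 1-f≤γ+¾+ε ⟩
    γ + + 3 / 4 + ε                    ≡⟨ *-identityʳ _ ⟨
    (γ + + 3 / 4 + ε) * 1ℚ             ≡⟨ cong ((γ + + 3 / 4 + ε) *_) (orientCost≡1 η η-orients makespan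
                                            (subst (_< (1ℚ - h) + N · w) (sym (*-identityʳ _)) 7/4+γ<heavy+N·w)) ⟨
    (γ + + 3 / 4 + ε) * orientCost η   ∎
    where open ≤-Reasoning
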